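{- Let $\Sigma_1,\Sigma_2,\Sigma_3$ be finite simplicial complexes such that ${\tt Ram}(\Sigma_2,\Sigma_3)$ is non-empty, and let $\Gamma$ be a subgroup of the symmetric group on $\Sigma_1^0$ whose elements map faces of $\Sigma_1$ to faces of $\Sigma_1$. Then there is a $\Gamma$-equivariant map \[ f:{\tt Ram}(\Sigma_1,\Sigma_2)\to{\tt Ram}(\Sigma_1,\Sigma_3), \] where $\Gamma$ acts on ${\tt Ram}(\Sigma_1,\Sigma_j)$ ($j=2,3$) by $(\gamma,\eta)\mapsto\eta\gamma$ on vertices, extended to cells.
   Context: For a simplicial complex $\Sigma$, $\Sigma^0$ is its vertex set. For a finite set $V$, $\Delta_V$ is the simplex on $V$. The vertices of $\prod_{i\in I}\Delta_V$ are functions $\eta:I\to V$ and its cells are functions $\nu:I\to 2^V\setminus\{\emptyset\}$; a cell $\nu$ belongs to the induced subcomplex on a vertex set $E$ if every $\eta$ with $\eta(i)\in\nu(i)$ for all $i$ lies in $E$. For finite simplicial complexes $\Sigma_1,\Sigma_2$, ${\tt Ram}(\Sigma_1,\Sigma_2)$ is the induced subcomplex of $\prod_{v\in\Sigma_1^0}\Delta_{\Sigma_2^0}$ on the vertex set $\{\eta:\Sigma_1^0\to\Sigma_2^0\mid \eta^{ -1}(\sigma)\in\Sigma_1\text{ for all faces }\sigma\in\Sigma_2\}$. A cell $\nu$ is mapped by $\gamma$ to the cell $i\mapsto\nu(\gamma(i))$. -}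

module Defs where

open import Data.Nat using (ℕ)
open import Data.Fin using (Fin)
open import Data.Fin.Subset using (Subset; _∈_; _⊆_; ⁅_⁆; Nonempty) renaming (⊥ to ∅)
open import Data.Fin.Permutation using (Permutation′; _⟨$⟩ʳ_; _⟨$⟩ˡ_; id; flip; _∘ₚ_)
open import Data.Vec using (tabulate; lookup)
import Data.Product
open import Data.Product using (Σ; ∃; _×_)
open import Relation.Binary.PropositionalEquality using (_≡_)
open import Level using (Level; suc)

preimage : ∀ {m n} → (Fin m → Fin n) → Subset n → Subset m
preimage f σ = tabulate (λ i → lookup σ (f i))

-- Image of a subset under a permutation γ: {γ i | i ∈ σ} = preimage of σ under γ⁻¹.
image : ∀ {n} → Permutation′ n → Subset n → Subset n
image γ σ = preimage (γ ⟨$⟩ˡ_) σ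

record SimplicialComplex (n : ℕ) : Set₁ where
  field
    Face  : Subset n → Set
    down  : ∀ {σ τ} → τ ⊆ σ → Face σ → Face τ
    vert  : ∀ i → Face ⁅ i ⁆
    empty : Face ∅
open SimplicialComplex public

IsRamVertex : ∀ {n₁ n₂} → SimplicialComplex n₁ → SimplicialComplex n₂ → (Fin n₁ → Fin n₂) → Set
IsRamVertex Σ₁ Σ₂ η = ∀ σ → Face Σ₂ σ → Face Σ₁ (preimage η σ)

-- Cells of the product ∏_{i ∈ Σ₁⁰} Δ_{Σ₂⁰}: functions ν : Σ₁⁰ → nonempty subsets of Σ₂⁰.
-- Cells of Ram(Σ₁,Σ₂): those all of whose vertices η (η i ∈ ν i for all i) are Ram vertices.
IsRamCell : ∀ {n₁ n₂} → SimplicialComplex n₁ → SimplicialComplex n₂ → (Fin n₁ → Subset n₂) → Set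
IsRamCell Σ₁ Σ₂ ν =
  (∀ i → Nonempty (ν i)) × (∀ (η : Fin _ → Fin _) → (∀ i → η i ∈ ν i) → IsRamVertex Σ₁ Σ₂ η)

RamCell : ∀ {n₁ n₂} → SimplicialComplex n₁ → SimplicialComplex n₂ → Set
RamCell {n₁} {n₂} Σ₁ Σ₂ = Σ (Fin n₁ → Subset n₂) (IsRamCell Σ₁ Σ₂)

RamNonempty : ∀ {n₁ n₂} → SimplicialComplex n₁ → SimplicialComplex n₂ → Set
RamNonempty {n₁} {n₂} Σ₁ Σ₂ = ∃ λ (η : Fin n₁ → Fin n₂) → IsRamVertex Σ₁ Σ₂ η

_≤ᶜ_ : ∀ {n₁ n₂} → (Fin n₁ → Subset n₂) → (Fin n₁ → Subset n₂) → Set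
ν ≤ᶜ μ = ∀ i → ν i ⊆ μ i

record IsSubgroup {n : ℕ} (Γ : Permutation′ n → Set) : Set where
  field
    has-id  : Γ id
    has-∘   : ∀ {γ δ} → Γ γ → Γ δ → Γ (γ ∘ₚ δ)
    has-inv : ∀ {γ} → Γ γ → Γ (flip γ)
open IsSubgroup public

PreservesFaces : ∀ {n} → SimplicialComplex n → (Permutation′ n → Set) → Set
PreservesFaces Σ Γ = ∀ γ → Γ γ → ∀ σ → Face Σ σ → Face Σ (image γ σ)

-- A Γ-equivariant map of cell complexes f : Ram(Σ₁,Σ₂) → Ram(Σ₁,Σ₃), given combinatorially
-- as a map on cells preserving the face relation and commuting with the action
-- ν ↦ ν ∘ γ (i ↦ ν(γ i)).
record EquivariantCellMap {n₁ n₂ n₃} (Σ₁ : SimplicialComplex n₁) (Σ₂ : SimplicialComplex n₂)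
    (Σ₃ : SimplicialComplex n₃) (Γ : Permutation′ n₁ → Set) : Set₁ where
  field
    map       : RamCell Σ₁ Σ₂ → RamCell Σ₁ Σ₃
    monotone  : ∀ (c d : RamCell Σ₁ Σ₂) → Data.Product.proj₁ c ≤ᶜ Data.Product.proj₁ d →
                Data.Product.proj₁ (map c) ≤ᶜ Data.Product.proj₁ (map d)
    equivariant : ∀ γ → Γ γ → ∀ (ν : Fin n₁ → Subset n₂) (p : IsRamCell Σ₁ Σ₂ ν)
                  (q : IsRamCell Σ₁ Σ₂ (λ i → ν (γ ⟨$⟩ʳ i))) →
                  ∀ i → Data.Product.proj₁ (map (_ Data.Product., q)) i
                        ≡ Data.Product.proj₁ (map (ν Data.Product., p)) (γ ⟨$⟩ʳ i)

module Submission where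

-- A vertex η of Ram(Σ₂,Σ₃) induces, by postcomposition, a map
-- Ram(Σ₁,Σ₂) → Ram(Σ₁,Σ₃): on vertices θ ↦ η ∘ θ, and on cells
-- ν ↦ (i ↦ η[ν i]), the direct image of each coordinate.  This is well
-- defined because preimages compose, (η ∘ θ)⁻¹(σ) = θ⁻¹(η⁻¹(σ)), so a
-- composite of Ram vertices is a Ram vertex; every vertex of the image cell
-- lifts along η to a vertex of ν.  Direct images are monotone, so the map
-- preserves the face relation, and postcomposition commutes with the action
-- ν ↦ ν ∘ γ by precomposition, so the map is equivariant for every group Γ
-- (definitionally).

open import Defs
open import Data.Nat using (ℕ)
open import Data.Fin.Permutation using (Permutation′)
open import Data.Fin using (Fin; _≟_)
open import Data.Fin.Subset using (Subset; _∈_; _⊆_; Nonempty)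
open import Data.Fin.Subset.Properties using (_∈?_)
open import Data.Fin.Properties using (any?)
open import Data.Vec using (tabulate; lookup)
open import Data.Vec.Properties using (lookup∘tabulate; tabulate-cong; []=⇒lookup; lookup⇒[]=)
open import Data.Bool using (true)
open import Data.Product using (∃; _×_; _,_; proj₁; proj₂)
open import Function using (_∘_)
open import Relation.Nullary using (Dec; yes; no; does; _×-dec_)
open import Relation.Nullary.Decidable using (dec-true)
open import Relation.Binary.PropositionalEquality using (_≡_; _≗_; refl; sym; trans; cong; subst)

does-true⇒ : ∀ {a} {P : Set a} (d : Dec P) → does d ≡ true → P
does-true⇒ (yes p) _ = p
does-true⇒ (no _) ()

directImage : ∀ {m n} → (Fin m → Fin n) → Subset m → Subset n
directImage η s = tabulate (λ k → does (any? (λ j → (j ∈? s) ×-dec (η j ≟ k))))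

module _ {m n : ℕ} (η : Fin m → Fin n) where

  ∈-directImage⁺ : ∀ {s j} → j ∈ s → η j ∈ directImage η s
  ∈-directImage⁺ {s} {j} j∈s = lookup⇒[]= (η j) (directImage η s)
    (trans (lookup∘tabulate _ (η j))
           (dec-true (any? (λ j′ → (j′ ∈? s) ×-dec (η j′ ≟ η j))) (j , j∈s , refl)))

  ∈-directImage⁻ : ∀ {s k} → k ∈ directImage η s → ∃ λ j → j ∈ s × η j ≡ k
  ∈-directImage⁻ {s} {k} k∈ = does-true⇒ (any? (λ j → (j ∈? s) ×-dec (η j ≟ k)))
    (trans (sym (lookup∘tabulate _ k)) ([]=⇒lookup k∈))

  directImage-mono : ∀ {s t} → s ⊆ t → directImage η s ⊆ directImage η t
  directImage-mono s⊆t k∈ with ∈-directImage⁻ k∈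
  ... | j , j∈s , refl = ∈-directImage⁺ (s⊆t j∈s)

preimage-∘ : ∀ {l m n} (η : Fin m → Fin n) (θ : Fin l → Fin m) {ξ : Fin l → Fin n} →
             ξ ≗ η ∘ θ → ∀ σ → preimage θ (preimage η σ) ≡ preimage ξ σ
preimage-∘ η θ ξ≗ηθ σ = tabulate-cong λ i →
  trans (lookup∘tabulate (lookup σ ∘ η) (θ i)) (cong (lookup σ) (sym (ξ≗ηθ i)))

-- Ram vertices compose: θ ∈ Ram(Σ₁,Σ₂)⁰ and η ∈ Ram(Σ₂,Σ₃)⁰ give η ∘ θ ∈ Ram(Σ₁,Σ₃)⁰,
-- since the preimage of a face of Σ₃ under η ∘ θ is θ⁻¹ of a face of Σ₂.
ramVertex-∘ : ∀ {l m n} (Σ₁ : SimplicialComplex l) (Σ₂ : SimplicialComplex m)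
              (Σ₃ : SimplicialComplex n) {η : Fin m → Fin n} {θ : Fin l → Fin m}
              {ξ : Fin l → Fin n} → ξ ≗ η ∘ θ →
              IsRamVertex Σ₂ Σ₃ η → IsRamVertex Σ₁ Σ₂ θ → IsRamVertex Σ₁ Σ₃ ξ
ramVertex-∘ Σ₁ Σ₂ Σ₃ {η} {θ} ξ≗ηθ ηRam θRam σ σ∈Σ₃ =
  subst (Face Σ₁) (preimage-∘ η θ ξ≗ηθ σ) (θRam (preimage η σ) (ηRam σ σ∈Σ₃))

-- Postcomposition with a Ram vertex η : Σ₂⁰ → Σ₃⁰ sends cells of Ram(Σ₁,Σ₂) to cells
-- of Ram(Σ₁,Σ₃): each vertex ξ of the image cell factors as η ∘ θ with θ a vertex of ν.
module Postcompose {l m n : ℕ} (Σ₁ : SimplicialComplex l) (Σ₂ : SimplicialComplex m)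
                   (Σ₃ : SimplicialComplex n) (η : Fin m → Fin n)
                   (ηRam : IsRamVertex Σ₂ Σ₃ η) where

  postcompose : (Fin l → Subset m) → (Fin l → Subset n)
  postcompose ν i = directImage η (ν i)

  postcompose-cell : ∀ {ν} → IsRamCell Σ₁ Σ₂ ν → IsRamCell Σ₁ Σ₃ (postcompose ν)
  postcompose-cell {ν} (ν-nonempty , ν-vertices) = nonempty , vertices
    where
    nonempty : ∀ i → Nonempty (postcompose ν i)
    nonempty i = η (proj₁ (ν-nonempty i)) , ∈-directImage⁺ η (proj₂ (ν-nonempty i))

    vertices : ∀ ξ → (∀ i → ξ i ∈ postcompose ν i) → IsRamVertex Σ₁ Σ₃ ξ
    vertices ξ ξ∈ = ramVertex-∘ Σ₁ Σ₂ Σ₃ (λ i → sym (proj₂ (proj₂ (lift i))))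
                                            ηRam (ν-vertices θ (λ i → proj₁ (proj₂ (lift i))))
      where
      lift : ∀ i → ∃ λ j → j ∈ ν i × η j ≡ ξ i
      lift i = ∈-directImage⁻ η (ξ∈ i)

      θ : Fin l → Fin m
      θ i = proj₁ (lift i)

  postcompose-mono : ∀ {ν μ} → ν ≤ᶜ μ → postcompose ν ≤ᶜ postcompose μ
  postcompose-mono ν≤μ i = directImage-mono η (ν≤μ i)

-- Equivariance holds definitionally, because
-- postcomposition commutes with the action by precomposition.
proposition4 : ∀ {n₁ n₂ n₃ : ℕ}
    (Σ₁ : SimplicialComplex n₁) (Σ₂ : SimplicialComplex n₂) (Σ₃ : SimplicialComplex n₃) →
    RamNonempty Σ₂ Σ₃ →
    (Γ : Permutation′ n₁ → Set) → IsSubgroup Γ → PreservesFaces Σ₁ Γ →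
    EquivariantCellMap Σ₁ Σ₂ Σ₃ Γ
proposition4 Σ₁ Σ₂ Σ₃ (η , ηRam) Γ _ _ = record
  { map         = λ (ν , ν-cell) → postcompose ν , postcompose-cell ν-cell
  ; monotone    = λ _ _ → postcompose-mono
  ; equivariant = λ _ _ _ _ _ _ → refl
  }
  where open Postcompose Σ₁ Σ₂ Σ₃ η ηRam
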